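{- Let $M\in\mathrm{But}(2,\ell)$ be such that $2^{ -1/2}M$ has finite multiplicative order and its eigenvalues are primitive $k$-th roots of unity. If the eigenvalues $\lambda_1,\lambda_2$ of $M$ satisfy $\lambda_1=-\lambda_2$, then $k\le\ell$.
   Context: $\zeta_\ell=e^{2\pi i/\ell}$. $\mathrm{But}(2,\ell)$ is the set of $2\times 2$ matrices $M$ with all entries in $\langle\zeta_\ell\rangle$ satisfying $MM^\ast=2I_2$, with $M^\ast$ the conjugate transpose. -}

module Defs where

open import Level using (_⊔_)
open import Data.Nat as ℕ using (ℕ; zero; suc)
open import Data.Fin using (Fin; zero; suc)
open import Data.Product using (_×_; ∃)
open import Data.Sum using (_⊎_)
open import Relation.Nullary using (¬_)
open import Algebra.Bundles using (CommutativeRing)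

-- 2×2 matrices and the notions used in the statement, over an arbitrary
-- commutative ring R (the statement specialises R to a characteristic-0
-- integral domain containing a primitive ℓ-th root of unity and √2).
module RingDefs {c r} (R : CommutativeRing c r) where
  open CommutativeRing R renaming (Carrier to K) hiding (zero)

  infixr 8 _^_
  _^_ : K → ℕ → K
  x ^ zero  = 1#
  x ^ suc n = x * (x ^ n)

  ⟦_⟧ : ℕ → K
  ⟦ zero ⟧  = 0#
  ⟦ suc n ⟧ = 1# + ⟦ n ⟧

  CharZero : Set r
  CharZero = ∀ n → ¬ (⟦ suc n ⟧ ≈ 0#)

  NoZeroDivisors : Set (c ⊔ r)
  NoZeroDivisors = ∀ x y → x * y ≈ 0# → (x ≈ 0#) ⊎ (y ≈ 0#)

  PrimitiveRoot : ℕ → K → Set r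
  PrimitiveRoot k x =
    (1 ℕ.≤ k) × (x ^ k ≈ 1#) × (∀ m → 1 ℕ.≤ m → m ℕ.< k → ¬ (x ^ m ≈ 1#))

  Mat : Set c
  Mat = Fin 2 → Fin 2 → K

  _⊗_ : Mat → Mat → Mat
  (A ⊗ B) i j = A i zero * B zero j + A i (suc zero) * B (suc zero) j

  I₂ : Mat
  I₂ zero zero = 1#
  I₂ zero (suc _) = 0#
  I₂ (suc _) zero = 0#
  I₂ (suc _) (suc _) = 1#

  _∙ₘ_ : K → Mat → Mat
  (a ∙ₘ A) i j = a * A i j

  _≈ₘ_ : Mat → Mat → Set r
  A ≈ₘ B = ∀ i j → A i j ≈ B i j

  matPow : Mat → ℕ → Mat
  matPow A zero    = I₂
  matPow A (suc n) = A ⊗ matPow A n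

  tr : Mat → K
  tr A = A zero zero + A (suc zero) (suc zero)

  det : Mat → K
  det A = A zero zero * A (suc zero) (suc zero) - A zero (suc zero) * A (suc zero) zero

  -- λ₁, λ₂ are the eigenvalues (with multiplicity) of A, i.e.
  -- the characteristic polynomial t² - tr(A) t + det(A) equals (t - λ₁)(t - λ₂)
  Eigenvalues : Mat → K → K → Set r
  Eigenvalues A λ₁ λ₂ = (λ₁ + λ₂ ≈ tr A) × (λ₁ * λ₂ ≈ det A)

  -- Matrices with entries in ⟨ζ⟩, given by an exponent matrix e:
  -- entry (i,j) is ζ ^ e i j.
  mat : (ζ : K) → (Fin 2 → Fin 2 → ℕ) → Mat
  mat ζ e i j = ζ ^ e i j

  -- Conjugate transpose of mat ζ e, where ζ is a primitive ℓ-th root of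
  -- unity: the complex conjugate of ζ^a is ζ^(-a) = ζ^(a·(ℓ-1)).
  conjT : (ℓ : ℕ) (ζ : K) → (Fin 2 → Fin 2 → ℕ) → Mat
  conjT ℓ ζ e i j = ζ ^ (e j i ℕ.* (ℓ ℕ.∸ 1))

  IsButson : (ℓ : ℕ) (ζ : K) → (Fin 2 → Fin 2 → ℕ) → Set r
  IsButson ℓ ζ e = (mat ζ e ⊗ conjT ℓ ζ e) ≈ₘ (⟦ 2 ⟧ ∙ₘ I₂)

-- Write M = [[a, b], [c, d]] with entries powers of ζ. Eigenvalues λ and -λ force
-- tr M = a + d = 0, and orthogonality of the rows of M forces the permanent ad + bc
-- to vanish, so λ² = -det M = 2a². With λ = √2 μ this gives μ² = a², hence μ = a or
-- μ = -a = d. Either way μ is a power of ζ, so μ^ℓ = 1, and as μ is a primitive k-th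
-- root of unity, k ≤ ℓ.
module Submission where

open import Defs
open import Level using (Level)
open import Data.Nat using (ℕ; _≤_; suc)
open import Data.Fin using (Fin)
open import Data.Product using (∃)
open import Algebra.Bundles using (CommutativeRing)

open import Data.Nat as ℕ using (zero; s≤s; z≤n; _∸_)
import Data.Nat.Properties as ℕₚ
open import Data.Fin using (zero; suc)
open import Data.Product using (_,_; proj₁; proj₂)
open import Data.Sum using (_⊎_; inj₁; inj₂; map₂; [_,_]′)
open import Data.Empty using (⊥-elim)
open import Relation.Nullary using (¬_; yes; no)
open import Relation.Binary.PropositionalEquality as ≡ using (_≡_)
import Relation.Binary.Reasoning.Setoid as SetoidReasoning
import Algebra.Properties.Ring as RingProperties
import Algebra.Solver.Ring.NaturalCoefficients.Default as NaturalCoefficientsSolver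

module Powers {ℓ₁ ℓ₂} (R : CommutativeRing ℓ₁ ℓ₂) where
  open CommutativeRing R renaming (Carrier to K) hiding (zero)
  open RingDefs R
  open SetoidReasoning setoid

  ^-congˡ : ∀ {x y} n → x ≈ y → x ^ n ≈ y ^ n
  ^-congˡ zero    x≈y = refl
  ^-congˡ (suc n) x≈y = *-cong x≈y (^-congˡ n x≈y)

  ^-congʳ : ∀ x {m n} → m ≡ n → x ^ m ≈ x ^ n
  ^-congʳ x ≡.refl = refl

  ^-homo-* : ∀ x m n → x ^ (m ℕ.+ n) ≈ x ^ m * x ^ n
  ^-homo-* x zero    n = sym (*-identityˡ _)
  ^-homo-* x (suc m) n = trans (*-congˡ (^-homo-* x m n)) (sym (*-assoc _ _ _))

  ^-assocʳ : ∀ x m n → (x ^ m) ^ n ≈ x ^ (m ℕ.* n)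
  ^-assocʳ x m zero    = ^-congʳ x (≡.sym (ℕₚ.*-zeroʳ m))
  ^-assocʳ x m (suc n) = begin
    x ^ m * (x ^ m) ^ n      ≈⟨ *-congˡ (^-assocʳ x m n) ⟩
    x ^ m * x ^ (m ℕ.* n)    ≈⟨ ^-homo-* x m (m ℕ.* n) ⟨
    x ^ (m ℕ.+ m ℕ.* n)      ≈⟨ ^-congʳ x (ℕₚ.*-suc m n) ⟨
    x ^ (m ℕ.* suc n)        ∎

  1^n≈1 : ∀ n → 1# ^ n ≈ 1#
  1^n≈1 zero    = refl
  1^n≈1 (suc n) = trans (*-identityˡ _) (1^n≈1 n)

  module _ {L : ℕ} {x : K} (x^L≈1 : x ^ L ≈ 1#) where

    ^-root : ∀ m → (x ^ m) ^ L ≈ 1#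
    ^-root m = begin
      (x ^ m) ^ L     ≈⟨ ^-assocʳ x m L ⟩
      x ^ (m ℕ.* L)   ≈⟨ ^-congʳ x (ℕₚ.*-comm m L) ⟩
      x ^ (L ℕ.* m)   ≈⟨ ^-assocʳ x L m ⟨
      (x ^ L) ^ m     ≈⟨ ^-congˡ m x^L≈1 ⟩
      1# ^ m          ≈⟨ 1^n≈1 m ⟩
      1#              ∎

    ^-inverse : 1 ≤ L → ∀ n → x ^ n * x ^ (n ℕ.* (L ∸ 1)) ≈ 1#
    ^-inverse (s≤s {n = L-1} z≤n) n = begin
      x ^ n * x ^ (n ℕ.* L-1)   ≈⟨ ^-homo-* x n (n ℕ.* L-1) ⟨
      x ^ (n ℕ.+ n ℕ.* L-1)     ≈⟨ ^-congʳ x (ℕₚ.*-suc n L-1) ⟨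
      x ^ (n ℕ.* L)             ≈⟨ ^-assocʳ x n L ⟨
      (x ^ n) ^ L               ≈⟨ ^-root n ⟩
      1#                        ∎

  primitiveRoot-order-≤ : ∀ {k L x} → PrimitiveRoot k x → 1 ≤ L → x ^ L ≈ 1# → k ≤ L
  primitiveRoot-order-≤ {k} {L} (_ , _ , minimal) 1≤L x^L≈1 with k ℕ.≤? L
  ... | yes k≤L = k≤L
  ... | no  k≰L = ⊥-elim (minimal L 1≤L (ℕₚ.≰⇒> k≰L) x^L≈1)

module RingLemmas {ℓ₁ ℓ₂} (R : CommutativeRing ℓ₁ ℓ₂) where
  open CommutativeRing R renaming (Carrier to K) hiding (zero)
  open RingDefs R
  open RingProperties ring
  open SetoidReasoning setoid
  open NaturalCoefficientsSolver commutativeSemiring using (solve; _:=_; _:+_; _:*_)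

  ⟦2⟧*x≈x+x : ∀ x → ⟦ 2 ⟧ * x ≈ x + x
  ⟦2⟧*x≈x+x x = begin
    (1# + (1# + 0#)) * x     ≈⟨ distribʳ x 1# (1# + 0#) ⟩
    1# * x + (1# + 0#) * x   ≈⟨ +-congˡ (*-congʳ (+-identityʳ 1#)) ⟩
    1# * x + 1# * x          ≈⟨ +-cong (*-identityˡ x) (*-identityˡ x) ⟩
    x + x                    ∎

  module _ (noZeroDivisors : NoZeroDivisors) where

    *-cancelˡ-nonZero : ∀ {a x y} → ¬ a ≈ 0# → a * x ≈ a * y → x ≈ y
    *-cancelˡ-nonZero {a} {x} {y} a≉0 ax≈ay with noZeroDivisors a (x - y) a[x-y]≈0
      where
      a[x-y]≈0 : a * (x - y) ≈ 0#
      a[x-y]≈0 = begin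
        a * (x - y)       ≈⟨ x[y-z]≈xy-xz a x y ⟩
        a * x - a * y     ≈⟨ +-congʳ ax≈ay ⟩
        a * y - a * y     ≈⟨ -‿inverseʳ (a * y) ⟩
        0#                ∎
    ... | inj₁ a≈0   = ⊥-elim (a≉0 a≈0)
    ... | inj₂ x-y≈0 = x∙y⁻¹≈ε⇒x≈y _ _ x-y≈0

    x²≈y²⇒x≈±y : ∀ {x y} → x * x ≈ y * y → x ≈ y ⊎ x ≈ - y
    x²≈y²⇒x≈±y {x} {y} x²≈y² with noZeroDivisors (x - y) (x + y) [x-y][x+y]≈0
      where
      -- the solver has no negation, so - y enters as an independent variable
      [x-y][x+y]≈0 : (x - y) * (x + y) ≈ 0#
      [x-y][x+y]≈0 = begin
        (x + - y) * (x + y)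
          ≈⟨ solve 3 (λ x y y⁻ → (x :+ y⁻) :* (x :+ y) := x :* x :+ y⁻ :* y :+ x :* (y :+ y⁻))
                     refl x y (- y) ⟩
        x * x + - y * y + x * (y - y)  ≈⟨ +-cong (+-cong x²≈y² (sym (-‿distribˡ-* y y))) (*-congˡ (-‿inverseʳ y)) ⟩
        y * y - y * y + x * 0#         ≈⟨ +-cong (-‿inverseʳ (y * y)) (zeroʳ x) ⟩
        0# + 0#                        ≈⟨ +-identityʳ 0# ⟩
        0#                             ∎
    ... | inj₁ x-y≈0 = inj₁ (x∙y⁻¹≈ε⇒x≈y _ _ x-y≈0)
    ... | inj₂ x+y≈0 = inj₂ (+-inverseˡ-unique x y x+y≈0)

module TwoByTwo {ℓ₁ ℓ₂} (R : CommutativeRing ℓ₁ ℓ₂) where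
  open CommutativeRing R renaming (Carrier to K) hiding (zero)
  open RingDefs R
  open RingProperties ring
  open SetoidReasoning setoid
  open NaturalCoefficientsSolver commutativeSemiring using (solve; _:=_; _:+_; _:*_)
  open RingLemmas R
  open Powers R using (^-inverse)

  perm : Mat → K
  perm A = A zero zero * A (suc zero) (suc zero) + A zero (suc zero) * A (suc zero) zero

  -- Orthogonality of the rows of a Butson matrix, with the conjugates of the
  -- roots of unity c, d written as their inverses; clearing denominators gives ad + bc = 0.
  orthogonal-units⇒cross≈0 : ∀ {a b u v u⁻¹ v⁻¹} → u * u⁻¹ ≈ 1# → v * v⁻¹ ≈ 1# →
                             a * u⁻¹ + b * v⁻¹ ≈ 0# → a * v + b * u ≈ 0#
  orthogonal-units⇒cross≈0 {a} {b} {u} {v} {u⁻¹} {v⁻¹} uu⁻¹≈1 vv⁻¹≈1 orthogonal = begin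
    a * v + b * u                          ≈⟨ +-cong (*-identityʳ _) (*-identityʳ _) ⟨
    a * v * 1# + b * u * 1#                ≈⟨ +-cong (*-congˡ uu⁻¹≈1) (*-congˡ vv⁻¹≈1) ⟨
    a * v * (u * u⁻¹) + b * u * (v * v⁻¹)
      ≈⟨ solve 6 (λ a b u v u⁻¹ v⁻¹ →
                   a :* v :* (u :* u⁻¹) :+ b :* u :* (v :* v⁻¹) := u :* v :* (a :* u⁻¹ :+ b :* v⁻¹))
                 refl a b u v u⁻¹ v⁻¹ ⟩
    u * v * (a * u⁻¹ + b * v⁻¹)            ≈⟨ *-congˡ orthogonal ⟩
    u * v * 0#                             ≈⟨ zeroʳ _ ⟩
    0#                                     ∎

  module _ (A : Mat) {λ₁ λ₂ : K} (eigenvalues : Eigenvalues A λ₁ λ₂) (λ₁≈-λ₂ : λ₁ ≈ - λ₂) where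

    tr≈0 : tr A ≈ 0#
    tr≈0 = begin
      tr A      ≈⟨ proj₁ eigenvalues ⟨
      λ₁ + λ₂   ≈⟨ +-congʳ λ₁≈-λ₂ ⟩
      - λ₂ + λ₂ ≈⟨ -‿inverseˡ λ₂ ⟩
      0#        ∎

    eigenvalue²≈-det : λ₁ * λ₁ ≈ - det A
    eigenvalue²≈-det = begin
      λ₁ * λ₁     ≈⟨ *-congˡ λ₁≈-λ₂ ⟩
      λ₁ * - λ₂   ≈⟨ -‿distribʳ-* λ₁ λ₂ ⟨
      - (λ₁ * λ₂) ≈⟨ -‿cong (proj₂ eigenvalues) ⟩
      - det A     ∎

  -det≈2a² : ∀ A → tr A ≈ 0# → perm A ≈ 0# →
             - det A ≈ A zero zero * A zero zero + A zero zero * A zero zero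
  -det≈2a² A tr≈0 perm≈0 = begin
    - (a * d - b * c)        ≈⟨ -‿cong (+-congˡ (-‿cong bc≈-ad)) ⟩
    - (a * d + - - (a * d))  ≈⟨ -‿cong (+-congˡ (-‿involutive (a * d))) ⟩
    - (a * d + a * d)        ≈⟨ -‿+-comm (a * d) (a * d) ⟨
    - (a * d) + - (a * d)    ≈⟨ +-cong -ad≈a² -ad≈a² ⟩
    a * a + a * a            ∎
    where
    a = A zero zero
    b = A zero (suc zero)
    c = A (suc zero) zero
    d = A (suc zero) (suc zero)
    bc≈-ad : b * c ≈ - (a * d)
    bc≈-ad = +-inverseʳ-unique (a * d) (b * c) perm≈0
    -ad≈a² : - (a * d) ≈ a * a
    -ad≈a² = begin
      - (a * d)  ≈⟨ -‿distribʳ-* a d ⟩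
      a * - d    ≈⟨ *-congˡ (-‿cong (+-inverseʳ-unique a d tr≈0)) ⟩
      a * - - a  ≈⟨ *-congˡ (-‿involutive a) ⟩
      a * a      ∎

  butson⇒perm≈0 : ∀ {ℓ ζ} e → 1 ≤ ℓ → ζ ^ ℓ ≈ 1# → IsButson ℓ ζ e → perm (mat ζ e) ≈ 0#
  butson⇒perm≈0 e 1≤ℓ ζ^ℓ≈1 butson =
    orthogonal-units⇒cross≈0 (^-inverse ζ^ℓ≈1 1≤ℓ (e (suc zero) zero))
                             (^-inverse ζ^ℓ≈1 1≤ℓ (e (suc zero) (suc zero)))
                             (trans (butson zero (suc zero)) (zeroʳ ⟦ 2 ⟧))

  module _ (charZero : CharZero) (noZeroDivisors : NoZeroDivisors) where

    scaledEigenvalue∈diagonal : ∀ A {λ₁ λ₂ s μ} → s * s ≈ ⟦ 2 ⟧ → λ₁ ≈ s * μ →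
                                Eigenvalues A λ₁ λ₂ → λ₁ ≈ - λ₂ → perm A ≈ 0# →
                                μ ≈ A zero zero ⊎ μ ≈ A (suc zero) (suc zero)
    scaledEigenvalue∈diagonal A {λ₁} {λ₂} {s} {μ} s²≈2 λ₁≈sμ eigenvalues λ₁≈-λ₂ perm≈0 =
      map₂ (λ μ≈-a → trans μ≈-a (sym (+-inverseʳ-unique a _ trA≈0)))
           (x²≈y²⇒x≈±y noZeroDivisors (*-cancelˡ-nonZero noZeroDivisors (charZero 1) 2μ²≈2a²))
      where
      a = A zero zero
      trA≈0 = tr≈0 A eigenvalues λ₁≈-λ₂
      2μ²≈2a² : ⟦ 2 ⟧ * (μ * μ) ≈ ⟦ 2 ⟧ * (a * a)
      2μ²≈2a² = begin
        ⟦ 2 ⟧ * (μ * μ)    ≈⟨ *-congʳ s²≈2 ⟨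
        s * s * (μ * μ)    ≈⟨ solve 2 (λ s μ → s :* s :* (μ :* μ) := s :* μ :* (s :* μ)) refl s μ ⟩
        s * μ * (s * μ)    ≈⟨ *-cong λ₁≈sμ λ₁≈sμ ⟨
        λ₁ * λ₁            ≈⟨ eigenvalue²≈-det A eigenvalues λ₁≈-λ₂ ⟩
        - det A            ≈⟨ -det≈2a² A trA≈0 perm≈0 ⟩
        a * a + a * a      ≈⟨ ⟦2⟧*x≈x+x (a * a) ⟨
        ⟦ 2 ⟧ * (a * a)    ∎

open Powers using (^-congˡ; ^-root; primitiveRoot-order-≤)
open TwoByTwo using (butson⇒perm≈0; scaledEigenvalue∈diagonal)

lemma3p13 : ∀ {c r : Level} (R : CommutativeRing c r) →
    let open CommutativeRing R renaming (Carrier to K)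
        open RingDefs R
    in CharZero → NoZeroDivisors →
       (ℓ : ℕ) (ζ : K) → PrimitiveRoot ℓ ζ →
       (s : K) → s * s ≈ ⟦ 2 ⟧ →
       (e : Fin 2 → Fin 2 → ℕ) → IsButson ℓ ζ e →
       -- M / sqrt 2 has finite multiplicative order
       (∃ λ n → (matPow (mat ζ e) (suc n)) ≈ₘ ((s ^ suc n) ∙ₘ I₂)) →
       (k : ℕ) (λ₁ λ₂ μ₁ μ₂ : K) →
       Eigenvalues (mat ζ e) λ₁ λ₂ →
       -- eigenvalues of M / sqrt 2 are μᵢ = λᵢ / s, primitive k-th roots of unity
       λ₁ ≈ s * μ₁ → λ₂ ≈ s * μ₂ →
       PrimitiveRoot k μ₁ → PrimitiveRoot k μ₂ →
       λ₁ ≈ - λ₂ →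
       k ≤ ℓ
lemma3p13 R charZero noZeroDivisors ℓ ζ (1≤ℓ , ζ^ℓ≈1 , _) s s²≈2 e butson _
          k λ₁ λ₂ μ₁ μ₂ eigenvalues λ₁≈sμ₁ _ μ₁-primitive _ λ₁≈-λ₂ =
  primitiveRoot-order-≤ R μ₁-primitive 1≤ℓ μ₁^ℓ≈1
  where
  open CommutativeRing R using (_≈_; 1#; trans)
  open RingDefs R using (_^_; mat)
  μ₁^ℓ≈1 : μ₁ ^ ℓ ≈ 1#
  μ₁^ℓ≈1 = [ entry^ℓ≈1 zero zero , entry^ℓ≈1 (suc zero) (suc zero) ]′
             (scaledEigenvalue∈diagonal R charZero noZeroDivisors (mat ζ e) s²≈2 λ₁≈sμ₁ eigenvalues λ₁≈-λ₂
                                        (butson⇒perm≈0 R e 1≤ℓ ζ^ℓ≈1 butson))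
    where
    entry^ℓ≈1 : ∀ i j → μ₁ ≈ mat ζ e i j → μ₁ ^ ℓ ≈ 1#
    entry^ℓ≈1 i j μ₁≈Mᵢⱼ = trans (^-congˡ R ℓ μ₁≈Mᵢⱼ) (^-root R {ℓ} {ζ} ζ^ℓ≈1 (e i j))
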